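{- Every expression of $DLKV$ (formula, term, or event) is reducible. As a consequence, $DLKV$ and its static fragment $LKV$ have the same expressive power.
   Context: Vocabulary: agents $\mathcal A$; constants $C$ containing $0,1$ and an "undefined" constant $\uparrow$; basic local variables $V$, each owned by an agent ($v_a$ owned by $a$); predicate symbols (including binary $=$) and function symbols with arities. Groups: finite non-empty $A\subseteq\mathcal A$; supergroups: finite non-empty sets $\mathfrak A$ of groups. Syntax of $DLKV$: terms $x::= c\mid v\mid x|_\varphi y\mid F(x_1,\dots,x_n)\mid x_A^\varphi\mid e(x)$; formulas $\varphi::=Px_1\dots x_n\mid\neg\varphi\mid\varphi\wedge\varphi\mid K_A\varphi\mid C_{\mathfrak A}^\theta\varphi\mid[e]\varphi$; events $e::=!\Phi/\sigma$, $\Phi$ a finite set of formulas, $\sigma$ assigning to each $v\in V$ a term $\sigma(v)$ and to each agent $a$ a set of agents $\sigma(a)$ with $a\in\sigma(a)$ and $K_a\sigma(v_a)\in\Phi$. $pre_e:=\bigwedge\Phi$, $e(a):=\sigma(a)$, $post_e(v):=\sigma(v)$, $e(A):=\bigcup_{a\in A}e(a)$, $e[\mathfrak A]:=\{e(A):A\in\mathfrak A\}$. The static fragment $LKV$ omits $[e]\varphi$ and $e(x)$. Reducibility: a $DLKV$-formula $\theta$ is reducible if $\theta\leftrightarrow\theta'$ is provable in $\mathbf{DLKV}$ for some $LKV$-formula $\theta'$; a $DLKV$-term $x$ is reducible if $x=x'$ is provable in $\mathbf{DLKV}$ for some $LKV$-term $x'$; an event $e=!\Phi/\sigma$ is reducible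 if all formulas in $\Phi$ and all terms $\sigma(v)$ ($v\in V$) are reducible. Abbreviations: $\top:=(\uparrow=\uparrow)$, $x\!\uparrow:=(x=\uparrow)$, $x\!\downarrow:=\neg x\!\uparrow$; $\overline x=\overline y$ is $\bigwedge_ix_i=y_i$; $K_a:=K_{\{a\}}$; $K_A^\theta\varphi:=K_A(\theta\to\varphi)$; $K_A^\theta x:=K_A^\theta(x=x_A^\theta)$; $K_A^\theta\overline x:=\bigwedge_iK_A^\theta x_i$; $K_Ax:=K_A^\top x$; $\langle K_A\rangle\varphi:=\neg K_A\neg\varphi$; $\langle e\rangle\varphi:=\neg[e]\neg\varphi$. Proof system $\mathbf{DLKV}$: (I) classical propositional tautologies and modus ponens. (II) $x=x$; $\overline x=\overline y\to(P\overline x\,\overline z\leftrightarrow P\overline y\,\overline z)$; $\overline x=\overline y\to F(\overline x)=F(\overline y)$; $(\varphi\to x|_\varphi y=x)\wedge(\neg\varphi\to x|_\varphi y=y)$. (III) from $\varphi$ infer $K_A\varphi$; $K_A(\varphi\to\psi)\to(K_A\varphi\to K_A\psi)$; $K_A\varphi\to\varphi$; $K_A\varphi\to K_AK_A\varphi$; $\neg K_A\varphi\to K_A\neg K_A\varphi$; $K_A\varphi\to K_B\varphi$ if $A\subseteq B$. (IV) from $\varphi$ infer $C_{\mathfrak A}^\theta\varphi$; $C_{\mathfrak A}^\theta(\varphi\to\psi)\to(C_{\mathfrak A}^\theta\varphi\to C_{\mathfrak A}^\theta\psi)$; $C_{\mathfrak A}^\theta\varphi\to(\varphi\wedge\bigwedge_{A\in\mathfrak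 A}K_A^\theta C_{\mathfrak A}^\theta\varphi)$; $C_{\mathfrak A}^\theta(\varphi\to\bigwedge_{A\in\mathfrak A}K_A^\theta\varphi)\to(\varphi\to C_{\mathfrak A}^\theta\varphi)$. (V) $x_A^\varphi\!\downarrow\to(K_A^\varphi x\wedge\langle K_A\rangle\varphi)$; $K_ac\wedge K_av_a$; $K_Ax_A^\varphi$; $K_A\overline x\to(P\overline x\to K_AP\overline x)$; $K_A^\varphi\overline x\to K_A^\varphi F(\overline x)$; $K_A^\theta(x=y)\to(K_A^\theta x\to K_A^\theta y)$; $K_A(\varphi\to\theta)\to(K_A^\theta x\to K_A^\varphi x)$. (VI) from $\varphi$ infer $[e]\varphi$; $[e](\varphi\to\psi)\to([e]\varphi\to[e]\psi)$; $[e]Px_1\dots x_n\leftrightarrow(pre_e\to Pe(x_1)\dots e(x_n))$; $[e]\neg\varphi\leftrightarrow(pre_e\to\neg[e]\varphi)$; $[e]K_A\varphi\leftrightarrow(pre_e\to K_{e(A)}[e]\varphi)$; $[e]C_{\mathfrak A}^\theta\varphi\leftrightarrow(pre_e\to C_{e[\mathfrak A]}^{\langle e\rangle\theta}[e]\varphi)$. (VII) $e(x)\!\downarrow\to pre_e$; $pre_e\to e(c)=c$; $pre_e\to e(v)=post_e(v)$; $pre_e\to e(x|_\varphi y)=e(x)|_{\langle e\rangle\varphi}e(y)$; $pre_e\to e(F(x_1,\dots,x_n))=F(e(x_1),\dots,e(x_n))$; $pre_e\to e(x_A^\varphi)=e(x)_{e(A)}^{\langle e\rangle\varphi}$. -}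

module Defs where

open import Data.Nat using (ℕ)
open import Data.Bool using (Bool; true; false; not) renaming (_∧_ to _&&_)
open import Data.List using (List; []; _∷_)
open import Data.List.NonEmpty using (List⁺; _∷_; toList; concatMap) renaming (map to map⁺)
open import Data.List.Membership.Propositional using (_∈_)
open import Data.List.Relation.Unary.All using () renaming (All to AllL)
open import Data.Vec using (Vec; []; _∷_)
open import Data.Vec.Relation.Unary.All using (All)
open import Data.Product using (Σ; _×_; _,_)
open import Relation.Binary.PropositionalEquality using (_≡_)

record Vocabulary : Set₁ where
  field
    Agent : Set
    -- constants, containing 0, 1 and the "undefined" constant ↑
    Const : Set
    c0 c1 c↑ : Const
    Var   : Set
    owner : Var → Agent
    Pred  : ℕ → Set
    Eq    : Pred 2
    Fun   : ℕ → Set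

data PF : Set where
  pvar : ℕ → PF
  pneg : PF → PF
  pand : PF → PF → PF

peval : (ℕ → Bool) → PF → Bool
peval ρ (pvar n)   = ρ n
peval ρ (pneg p)   = not (peval ρ p)
peval ρ (pand p q) = peval ρ p && peval ρ q

Tautology : PF → Set
Tautology p = (ρ : ℕ → Bool) → peval ρ p ≡ true

module Lang (𝒱 : Vocabulary) where
  open Vocabulary 𝒱

  -- groups: finite non-empty sets of agents; supergroups: finite
  -- non-empty sets of groups
  Group : Set
  Group = List⁺ Agent

  SuperGroup : Set
  SuperGroup = List⁺ Group

  ⟦_⟧ : Agent → Group
  ⟦ a ⟧ = a ∷ []

  data Term  : Set
  data Form  : Set
  data Event : Set
  knowsVal : Agent → Term → Form     -- K_a x  (= K_{a}^⊤ x)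

  infixr 30 _∧'_
  infix  35 ¬'_

  data Term where
    const : Const → Term
    var   : Var → Term
    cond  : Term → Form → Term → Term
    fun   : ∀ {n} → Fun n → Vec Term n → Term
    val   : Term → Group → Form → Term
    upd   : Event → Term → Term

  data Form where
    pred  : ∀ {n} → Pred n → Vec Term n → Form
    ¬'_   : Form → Form
    _∧'_  : Form → Form → Form
    K     : Group → Form → Form
    C     : SuperGroup → Form → Form → Form
    [_]_  : Event → Form → Form

  knowsVal a x =
    K ⟦ a ⟧ (¬' (pred Eq (const c↑ ∷ const c↑ ∷ [])
                 ∧' ¬' pred Eq (x ∷ val x ⟦ a ⟧ (pred Eq (const c↑ ∷ const c↑ ∷ [])) ∷ [])))

  data Event where
    ev : (Φ : List Form) (σv : Var → Term) (σa : Agent → List⁺ Agent) →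
         ((a : Agent) → a ∈ toList (σa a)) →
         ((v : Var) → knowsVal (owner v) (σv v) ∈ Φ) →
         Event

  infixr 20 _⇒_
  infix  15 _⇔_
  infix  40 _≐_

  _≐_ : Term → Term → Form
  x ≐ y = pred Eq (x ∷ y ∷ [])

  ↑' : Term
  ↑' = const c↑

  ⊤' : Form
  ⊤' = ↑' ≐ ↑'

  _↑ : Term → Form
  x ↑ = x ≐ ↑'

  _↓ : Term → Form
  x ↓ = ¬' (x ↑)

  _⇒_ : Form → Form → Form
  φ ⇒ ψ = ¬' (φ ∧' ¬' ψ)

  _⇔_ : Form → Form → Form
  φ ⇔ ψ = (φ ⇒ ψ) ∧' (ψ ⇒ φ)

  ⋀ : List Form → Form
  ⋀ []       = ⊤'
  ⋀ (φ ∷ Φ)  = φ ∧' ⋀ Φ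

  ⋀⁺ : List⁺ Form → Form
  ⋀⁺ Φ = ⋀ (toList Φ)

  vecEq : ∀ {n} → Vec Term n → Vec Term n → Form
  vecEq []       []       = ⊤'
  vecEq (x ∷ xs) (y ∷ ys) = (x ≐ y) ∧' vecEq xs ys

  Kθ : Group → Form → Form → Form
  Kθ A θ φ = K A (θ ⇒ φ)

  KθT : Group → Form → Term → Form
  KθT A θ x = Kθ A θ (x ≐ val x A θ)

  KθV : ∀ {n} → Group → Form → Vec Term n → Form
  KθV A θ []       = ⊤'
  KθV A θ (x ∷ xs) = KθT A θ x ∧' KθV A θ xs

  KT : Group → Term → Form
  KT A x = KθT A ⊤' x

  ⟨K_⟩_ : Group → Form → Form
  ⟨K A ⟩ φ = ¬' K A (¬' φ)

  ⟨_⟩_ : Event → Form → Form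
  ⟨ e ⟩ φ = ¬' ([ e ] ¬' φ)

  pre : Event → Form
  pre (ev Φ _ _ _ _) = ⋀ Φ

  post : Event → Var → Term
  post (ev _ σv _ _ _) = σv

  evAgent : Event → Agent → List⁺ Agent
  evAgent (ev _ _ σa _ _) = σa

  evGroup : Event → Group → Group
  evGroup e A = concatMap (evAgent e) A

  evSuper : Event → SuperGroup → SuperGroup
  evSuper e 𝔄 = map⁺ (evGroup e) 𝔄

  _⊆_ : Group → Group → Set
  A ⊆ B = ∀ {a} → a ∈ toList A → a ∈ toList B

  inst : (ℕ → Form) → PF → Form
  inst s (pvar n)   = s n
  inst s (pneg p)   = ¬' inst s p
  inst s (pand p q) = inst s p ∧' inst s q

  infix 5 ⊢_

  data ⊢_ : Form → Set where
    taut  : (p : PF) → Tautology p → (s : ℕ → Form) → ⊢ inst s p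
    mp    : ∀ {φ ψ} → ⊢ φ ⇒ ψ → ⊢ φ → ⊢ ψ
    refl≐ : ∀ x → ⊢ x ≐ x
    congP : ∀ {n} (P : Pred n) (xs ys : Vec Term n) →
            ⊢ vecEq xs ys ⇒ (pred P xs ⇔ pred P ys)
    congF : ∀ {n} (F : Fun n) (xs ys : Vec Term n) →
            ⊢ vecEq xs ys ⇒ (fun F xs ≐ fun F ys)
    condAx : ∀ x φ y →
            ⊢ (φ ⇒ (cond x φ y ≐ x)) ∧' (¬' φ ⇒ (cond x φ y ≐ y))
    necK  : ∀ {φ} A → ⊢ φ → ⊢ K A φ
    distK : ∀ A φ ψ → ⊢ K A (φ ⇒ ψ) ⇒ (K A φ ⇒ K A ψ)
    tK    : ∀ A φ → ⊢ K A φ ⇒ φ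
    4K    : ∀ A φ → ⊢ K A φ ⇒ K A (K A φ)
    5K    : ∀ A φ → ⊢ ¬' K A φ ⇒ K A (¬' K A φ)
    monoK : ∀ A B φ → A ⊆ B → ⊢ K A φ ⇒ K B φ
    necC  : ∀ {φ} 𝔄 θ → ⊢ φ → ⊢ C 𝔄 θ φ
    distC : ∀ 𝔄 θ φ ψ → ⊢ C 𝔄 θ (φ ⇒ ψ) ⇒ (C 𝔄 θ φ ⇒ C 𝔄 θ ψ)
    fixC  : ∀ 𝔄 θ φ →
            ⊢ C 𝔄 θ φ ⇒ (φ ∧' ⋀⁺ (map⁺ (λ A → Kθ A θ (C 𝔄 θ φ)) 𝔄))
    indC  : ∀ 𝔄 θ φ →
            ⊢ C 𝔄 θ (φ ⇒ ⋀⁺ (map⁺ (λ A → Kθ A θ φ) 𝔄)) ⇒ (φ ⇒ C 𝔄 θ φ)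
    valDef : ∀ x A φ → ⊢ ((val x A φ) ↓) ⇒ (KθT A φ x ∧' (⟨K A ⟩ φ))
    knowC  : ∀ a c → ⊢ KT ⟦ a ⟧ (const c)
    knowV  : ∀ v → ⊢ KT ⟦ owner v ⟧ (var v)
    knowVal : ∀ A x φ → ⊢ KT A (val x A φ)
    knowP  : ∀ {n} A (P : Pred n) (xs : Vec Term n) →
             ⊢ KθV A ⊤' xs ⇒ (pred P xs ⇒ K A (pred P xs))
    knowF  : ∀ {n} A φ (F : Fun n) (xs : Vec Term n) →
             ⊢ KθV A φ xs ⇒ KθT A φ (fun F xs)
    knowEq : ∀ A θ x y → ⊢ Kθ A θ (x ≐ y) ⇒ (KθT A θ x ⇒ KθT A θ y)
    knowAnti : ∀ A φ θ x → ⊢ K A (φ ⇒ θ) ⇒ (KθT A θ x ⇒ KθT A φ x)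
    nec[] : ∀ {φ} e → ⊢ φ → ⊢ [ e ] φ
    dist[] : ∀ e φ ψ → ⊢ ([ e ] (φ ⇒ ψ)) ⇒ (([ e ] φ) ⇒ ([ e ] ψ))
    red[]P : ∀ {n} e (P : Pred n) (xs : Vec Term n) →
             ⊢ ([ e ] pred P xs) ⇔ (pre e ⇒ pred P (Data.Vec.map (upd e) xs))
    red[]¬ : ∀ e φ → ⊢ ([ e ] (¬' φ)) ⇔ (pre e ⇒ ¬' ([ e ] φ))
    red[]K : ∀ e A φ → ⊢ ([ e ] K A φ) ⇔ (pre e ⇒ K (evGroup e A) ([ e ] φ))
    red[]C : ∀ e 𝔄 θ φ →
             ⊢ ([ e ] C 𝔄 θ φ) ⇔ (pre e ⇒ C (evSuper e 𝔄) (⟨ e ⟩ θ) ([ e ] φ))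
    updDef  : ∀ e x → ⊢ ((upd e x) ↓) ⇒ pre e
    updC    : ∀ e c → ⊢ pre e ⇒ (upd e (const c) ≐ const c)
    updV    : ∀ e v → ⊢ pre e ⇒ (upd e (var v) ≐ post e v)
    updCond : ∀ e x φ y →
              ⊢ pre e ⇒ (upd e (cond x φ y) ≐ cond (upd e x) (⟨ e ⟩ φ) (upd e y))
    updF    : ∀ {n} e (F : Fun n) (xs : Vec Term n) →
              ⊢ pre e ⇒ (upd e (fun F xs) ≐ fun F (Data.Vec.map (upd e) xs))
    updVal  : ∀ e x A φ →
              ⊢ pre e ⇒ (upd e (val x A φ) ≐ val (upd e x) (evGroup e A) (⟨ e ⟩ φ))

  -- The static fragment LKV: no [e]φ and no e(x)

  data StaticT : Term → Set
  data StaticF : Form → Set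

  data StaticT where
    const : ∀ c → StaticT (const c)
    var   : ∀ v → StaticT (var v)
    cond  : ∀ {x φ y} → StaticT x → StaticF φ → StaticT y → StaticT (cond x φ y)
    fun   : ∀ {n} {F : Fun n} {xs} → All StaticT xs → StaticT (fun F xs)
    val   : ∀ {x A φ} → StaticT x → StaticF φ → StaticT (val x A φ)

  data StaticF where
    pred : ∀ {n} {P : Pred n} {xs} → All StaticT xs → StaticF (pred P xs)
    ¬'_  : ∀ {φ} → StaticF φ → StaticF (¬' φ)
    _∧'_ : ∀ {φ ψ} → StaticF φ → StaticF ψ → StaticF (φ ∧' ψ)
    K    : ∀ {A φ} → StaticF φ → StaticF (K A φ)
    C    : ∀ {𝔄 θ φ} → StaticF θ → StaticF φ → StaticF (C 𝔄 θ φ)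

  ReducibleF : Form → Set
  ReducibleF θ = Σ Form (λ θ' → StaticF θ' × (⊢ θ ⇔ θ'))

  ReducibleT : Term → Set
  ReducibleT x = Σ Term (λ x' → StaticT x' × (⊢ x ≐ x'))

  ReducibleE : Event → Set
  ReducibleE (ev Φ σv _ _ _) = AllL ReducibleF Φ × ((v : Var) → ReducibleT (σv v))

{-# OPTIONS --safe #-}
-- Provable equivalence
-- and equality are congruences for all static constructors, so the static
-- ones preserve reducibility; for x_A^φ this rests on the fact that A knows
-- the values x_A^φ, so by S5 a value equation that A considers possible
-- holds. For [e]φ and e(x) one first reduces e, φ and x, and then pushes the
-- update through the static reduct with the axioms (VI) and (VII), by
-- induction on it: e(x) equals e(x)|_{pre_e}↑ because e(x)↓ → pre_e, and
-- ⟨e⟩θ is ¬[e]¬θ, so the condition of C_{e[𝔄]}^{⟨e⟩θ} is again of the form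
-- [e]θ'.
module Submission where

open import Defs
open import Data.Bool using (Bool; true; false; not; T) renaming (_∧_ to _&&_)
open import Data.Bool.Properties using (∧-conicalˡ; ∧-conicalʳ; T-≡)
open import Data.Nat using (ℕ; zero; suc; _<_; _⊔_; s≤s)
open import Data.Nat.Properties using (≤-refl; m<n⇒m<n⊔o; m<n⇒m<o⊔n)
open import Data.List as List using (List; []; _∷_)
open import Data.List.NonEmpty using (toList) renaming (map to map⁺)
open import Data.List.Relation.Unary.All using ([]; _∷_) renaming (All to AllL)
open import Data.Vec as Vec using (Vec; []; _∷_)
open import Data.Vec.Relation.Unary.All using (All; []; _∷_)
open import Data.Product using (Σ; _×_; _,_)
open import Data.Unit using (tt)  -- the instance that discharges T true in tautology
open import Function using (_∘_; Equivalence)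
open import Relation.Binary.PropositionalEquality as ≡ using (_≡_; refl)

arity : PF → ℕ
arity (pvar i)   = suc i
arity (pneg p)   = arity p
arity (pand p q) = arity p ⊔ arity q

peval-local : ∀ p {ρ ρ′ : ℕ → Bool} → (∀ {i} → i < arity p → ρ i ≡ ρ′ i) →
              peval ρ p ≡ peval ρ′ p
peval-local (pvar i)   agree = agree (s≤s ≤-refl)
peval-local (pneg p)   agree = ≡.cong not (peval-local p agree)
peval-local (pand p q) agree = ≡.cong₂ _&&_
  (peval-local p (agree ∘ m<n⇒m<n⊔o (arity q)))
  (peval-local q (agree ∘ m<n⇒m<o⊔n (arity p)))

valuation : ∀ {n} → Vec Bool n → ℕ → Bool
valuation []       _       = false
valuation (b ∷ bs) zero    = b
valuation (b ∷ bs) (suc i) = valuation bs i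

restrict : ∀ n → (ℕ → Bool) → Vec Bool n
restrict zero    ρ = []
restrict (suc n) ρ = ρ zero ∷ restrict n (ρ ∘ suc)

valuation-restrict : ∀ n ρ {i} → i < n → valuation (restrict n ρ) i ≡ ρ i
valuation-restrict (suc n) ρ {zero}  _         = refl
valuation-restrict (suc n) ρ {suc i} (s≤s i<n) = valuation-restrict n (ρ ∘ suc) i<n

every : ∀ n → (Vec Bool n → Bool) → Bool
every zero    f = f []
every (suc n) f = every n (f ∘ (true ∷_)) && every n (f ∘ (false ∷_))

every-sound : ∀ n f → every n f ≡ true → ∀ bs → f bs ≡ true
every-sound zero    f holds []           = holds
every-sound (suc n) f holds (true ∷ bs)  = every-sound n _ (∧-conicalˡ _ _ holds) bs
every-sound (suc n) f holds (false ∷ bs) = every-sound n _ (∧-conicalʳ _ _ holds) bs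

truthTable : PF → Bool
truthTable p = every (arity p) (λ bs → peval (valuation bs) p)

truthTable-sound : ∀ p → T (truthTable p) → Tautology p
truthTable-sound p holds ρ = ≡.trans
  (peval-local p (≡.sym ∘ valuation-restrict (arity p) ρ))
  (every-sound (arity p) _ (Equivalence.to T-≡ holds) (restrict (arity p) ρ))

infixr 20 _⇒ₚ_
infix  15 _⇔ₚ_
infixr 30 _∧ₚ_
infix  35 ¬ₚ_

p₀ p₁ p₂ p₃ p₄ : PF
p₀ = pvar 0
p₁ = pvar 1
p₂ = pvar 2
p₃ = pvar 3
p₄ = pvar 4

¬ₚ_ : PF → PF
¬ₚ_ = pneg

_∧ₚ_ : PF → PF → PF
_∧ₚ_ = pand

_⇒ₚ_ : PF → PF → PF
p ⇒ₚ q = ¬ₚ (p ∧ₚ ¬ₚ q)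

_⇔ₚ_ : PF → PF → PF
p ⇔ₚ q = (p ⇒ₚ q) ∧ₚ (q ⇒ₚ p)

module _ (𝒱 : Vocabulary) where
  open Vocabulary 𝒱
  open Lang 𝒱

  private variable
    n : ℕ
    φ φ′ ψ ψ′ χ θ θ′ h : Form
    Φ : List Form
    x x′ y y′ z z′ t t′ : Term
    xs : Vec Term n
    A : Group
    𝔄 : SuperGroup
    P : Pred n
    F : Fun n

  assign : List Form → ℕ → Form
  assign []       _       = ⊤'
  assign (φ ∷ φs) zero    = φ
  assign (φ ∷ φs) (suc i) = assign φs i

  tautology : (p : PF) → {{T (truthTable p)}} → (φs : List Form) → ⊢ inst (assign φs) p
  tautology p {{holds}} φs = taut p (truthTable-sound p holds) (assign φs)

  ⊢⊤ : ⊢ ⊤'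
  ⊢⊤ = refl≐ ↑'

  mp₂ : ⊢ φ ⇒ ψ ⇒ χ → ⊢ φ → ⊢ ψ → ⊢ χ
  mp₂ φ⇒ψ⇒χ ⊢φ ⊢ψ = mp (mp φ⇒ψ⇒χ ⊢φ) ⊢ψ

  ⇒-refl : ⊢ φ ⇒ φ
  ⇒-refl {φ} = tautology (p₀ ⇒ₚ p₀) (φ ∷ [])

  ⇒-trans : ⊢ φ ⇒ ψ → ⊢ ψ ⇒ χ → ⊢ φ ⇒ χ
  ⇒-trans {φ} {ψ} {χ} =
    mp₂ (tautology ((p₀ ⇒ₚ p₁) ⇒ₚ (p₁ ⇒ₚ p₂) ⇒ₚ p₀ ⇒ₚ p₂) (φ ∷ ψ ∷ χ ∷ []))

  ⇒-weaken : ⊢ ψ → ⊢ φ ⇒ ψ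
  ⇒-weaken {ψ} {φ} = mp (tautology (p₀ ⇒ₚ p₁ ⇒ₚ p₀) (ψ ∷ φ ∷ []))

  ⇒-discharge : ⊢ φ ⇒ ψ ⇒ χ → ⊢ ψ → ⊢ φ ⇒ χ
  ⇒-discharge {φ} {ψ} {χ} =
    mp₂ (tautology ((p₀ ⇒ₚ p₁ ⇒ₚ p₂) ⇒ₚ p₁ ⇒ₚ p₀ ⇒ₚ p₂) (φ ∷ ψ ∷ χ ∷ []))

  lift₂ : ⊢ φ ⇒ ψ ⇒ χ → ⊢ h ⇒ φ → ⊢ h ⇒ ψ → ⊢ h ⇒ χ
  lift₂ {φ} {ψ} {χ} {h} φ⇒ψ⇒χ = mp₂ (mp (tautology
    ((p₀ ⇒ₚ p₁ ⇒ₚ p₂) ⇒ₚ (p₃ ⇒ₚ p₀) ⇒ₚ (p₃ ⇒ₚ p₁) ⇒ₚ p₃ ⇒ₚ p₂) (φ ∷ ψ ∷ χ ∷ h ∷ [])) φ⇒ψ⇒χ)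

  by-cases : ⊢ φ ⇒ ψ → ⊢ ¬' φ ⇒ ψ → ⊢ ψ
  by-cases {φ} {ψ} = mp₂ (tautology ((p₀ ⇒ₚ p₁) ⇒ₚ (¬ₚ p₀ ⇒ₚ p₁) ⇒ₚ p₁) (φ ∷ ψ ∷ []))

  contraposition : ⊢ φ ⇒ ψ → ⊢ ¬' ψ ⇒ ¬' φ
  contraposition {φ} {ψ} = mp (tautology ((p₀ ⇒ₚ p₁) ⇒ₚ ¬ₚ p₁ ⇒ₚ ¬ₚ p₀) (φ ∷ ψ ∷ []))

  contraposition-¬ : ⊢ ¬' φ ⇒ ψ → ⊢ ¬' ψ ⇒ φ
  contraposition-¬ {φ} {ψ} = mp (tautology ((¬ₚ p₀ ⇒ₚ p₁) ⇒ₚ ¬ₚ p₁ ⇒ₚ p₀) (φ ∷ ψ ∷ []))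

  ∧-intro⇒ : ⊢ φ ⇒ ψ ⇒ φ ∧' ψ
  ∧-intro⇒ {φ} {ψ} = tautology (p₀ ⇒ₚ p₁ ⇒ₚ p₀ ∧ₚ p₁) (φ ∷ ψ ∷ [])

  ∧-intro : ⊢ φ → ⊢ ψ → ⊢ φ ∧' ψ
  ∧-intro = mp₂ ∧-intro⇒

  ∧-elimˡ : ⊢ φ ∧' ψ ⇒ φ
  ∧-elimˡ {φ} {ψ} = tautology (p₀ ∧ₚ p₁ ⇒ₚ p₀) (φ ∷ ψ ∷ [])

  ∧-elimʳ : ⊢ φ ∧' ψ ⇒ ψ
  ∧-elimʳ {φ} {ψ} = tautology (p₀ ∧ₚ p₁ ⇒ₚ p₁) (φ ∷ ψ ∷ [])

  uncurry : ⊢ φ ⇒ ψ ⇒ χ → ⊢ φ ∧' ψ ⇒ χ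
  uncurry {φ} {ψ} {χ} = mp (tautology ((p₀ ⇒ₚ p₁ ⇒ₚ p₂) ⇒ₚ p₀ ∧ₚ p₁ ⇒ₚ p₂) (φ ∷ ψ ∷ χ ∷ []))

  ∧-mono : ⊢ φ ⇒ φ′ → ⊢ ψ ⇒ ψ′ → ⊢ φ ∧' ψ ⇒ φ′ ∧' ψ′
  ∧-mono {φ} {φ′} {ψ} {ψ′} = mp₂ (tautology
    ((p₀ ⇒ₚ p₁) ⇒ₚ (p₂ ⇒ₚ p₃) ⇒ₚ p₀ ∧ₚ p₂ ⇒ₚ p₁ ∧ₚ p₃) (φ ∷ φ′ ∷ ψ ∷ ψ′ ∷ []))

  ⇒-mono : ⊢ φ′ ⇒ φ → ⊢ ψ ⇒ ψ′ → ⊢ (φ ⇒ ψ) ⇒ (φ′ ⇒ ψ′)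
  ⇒-mono {φ′} {φ} {ψ} {ψ′} = mp₂ (tautology
    ((p₁ ⇒ₚ p₀) ⇒ₚ (p₂ ⇒ₚ p₃) ⇒ₚ (p₀ ⇒ₚ p₂) ⇒ₚ p₁ ⇒ₚ p₃) (φ ∷ φ′ ∷ ψ ∷ ψ′ ∷ []))

  ⇔-to : ⊢ φ ⇔ ψ → ⊢ φ ⇒ ψ
  ⇔-to = mp ∧-elimˡ

  ⇔-from : ⊢ φ ⇔ ψ → ⊢ ψ ⇒ φ
  ⇔-from = mp ∧-elimʳ

  ⇔-refl : ⊢ φ ⇔ φ
  ⇔-refl = ∧-intro ⇒-refl ⇒-refl

  ⇔-sym : ⊢ φ ⇔ ψ → ⊢ ψ ⇔ φ
  ⇔-sym φ⇔ψ = ∧-intro (⇔-from φ⇔ψ) (⇔-to φ⇔ψ)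

  ⇔-trans : ⊢ φ ⇔ ψ → ⊢ ψ ⇔ χ → ⊢ φ ⇔ χ
  ⇔-trans φ⇔ψ ψ⇔χ = ∧-intro (⇒-trans (⇔-to φ⇔ψ) (⇔-to ψ⇔χ)) (⇒-trans (⇔-from ψ⇔χ) (⇔-from φ⇔ψ))

  ¬-cong : ⊢ φ ⇔ ψ → ⊢ ¬' φ ⇔ ¬' ψ
  ¬-cong φ⇔ψ = ∧-intro (contraposition (⇔-from φ⇔ψ)) (contraposition (⇔-to φ⇔ψ))

  ∧-cong : ⊢ φ ⇔ φ′ → ⊢ ψ ⇔ ψ′ → ⊢ φ ∧' ψ ⇔ φ′ ∧' ψ′
  ∧-cong φ⇔φ′ ψ⇔ψ′ = ∧-intro (∧-mono (⇔-to φ⇔φ′) (⇔-to ψ⇔ψ′)) (∧-mono (⇔-from φ⇔φ′) (⇔-from ψ⇔ψ′))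

  module Normal (□ : Form → Form) (nec : ∀ {φ} → ⊢ φ → ⊢ □ φ)
                (dist : ∀ φ ψ → ⊢ □ (φ ⇒ ψ) ⇒ □ φ ⇒ □ ψ) where

    mono : ⊢ φ ⇒ ψ → ⊢ □ φ ⇒ □ ψ
    mono φ⇒ψ = mp (dist _ _) (nec φ⇒ψ)

    mono₂ : ⊢ φ ⇒ ψ ⇒ χ → ⊢ □ φ ⇒ □ ψ ⇒ □ χ
    mono₂ φ⇒ψ⇒χ = ⇒-trans (mono φ⇒ψ⇒χ) (dist _ _)

    cong : ⊢ φ ⇔ ψ → ⊢ □ φ ⇔ □ ψ
    cong φ⇔ψ = ∧-intro (mono (⇔-to φ⇔ψ)) (mono (⇔-from φ⇔ψ))

    ∧-distrib : ⊢ □ (φ ∧' ψ) ⇔ □ φ ∧' □ ψ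
    ∧-distrib = ∧-intro (lift₂ ∧-intro⇒ (mono ∧-elimˡ) (mono ∧-elimʳ)) (uncurry (mono₂ ∧-intro⇒))

  module K-normal (A : Group) = Normal (K A) (necK A) (distK A)
  module C-normal (𝔄 : SuperGroup) (θ : Form) = Normal (C 𝔄 θ) (necC 𝔄 θ) (distC 𝔄 θ)
  module []-normal (e : Event) = Normal ([_]_ e) (nec[] e) (dist[] e)

  ⟨K⟩-distrib : ⊢ K A (φ ⇒ ψ) ⇒ (⟨K A ⟩ φ) ⇒ (⟨K A ⟩ ψ)
  ⟨K⟩-distrib {A} {φ} {ψ} =
    mp (tautology ((p₀ ⇒ₚ p₁ ⇒ₚ p₂) ⇒ₚ p₀ ⇒ₚ ¬ₚ p₂ ⇒ₚ ¬ₚ p₁)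
                  (K A (φ ⇒ ψ) ∷ K A (¬' ψ) ∷ K A (¬' φ) ∷ []))
       (K-normal.mono₂ A (tautology ((p₀ ⇒ₚ p₁) ⇒ₚ ¬ₚ p₁ ⇒ₚ ¬ₚ p₀) (φ ∷ ψ ∷ [])))

  ⟨K⟩-elim : ⊢ φ ⇒ K A φ → ⊢ (⟨K A ⟩ φ) ⇒ φ
  ⟨K⟩-elim {φ} {A} φ⇒Kφ =
    ⇒-trans (mp ⟨K⟩-distrib (necK A φ⇒Kφ)) (⇒-trans (contraposition-¬ (5K A φ)) (tK A φ))

  ≐-transport : ∀ x y z w → ⊢ x ≐ z ⇒ x ≐ y ⇒ z ≐ w ⇒ y ≐ w
  ≐-transport x y z w = mp₂
    (tautology ((p₀ ∧ₚ p₁ ∧ₚ p₂ ⇒ₚ (p₃ ⇔ₚ p₄)) ⇒ₚ p₂ ⇒ₚ p₃ ⇒ₚ p₀ ⇒ₚ p₁ ⇒ₚ p₄)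
               (x ≐ y ∷ z ≐ w ∷ ⊤' ∷ x ≐ z ∷ y ≐ w ∷ []))
    (congP Eq (x ∷ z ∷ []) (y ∷ w ∷ [])) ⊢⊤

  ≐-sym⇒ : ⊢ x ≐ y ⇒ y ≐ x
  ≐-sym⇒ {x} {y} = ⇒-discharge (mp (≐-transport x y x x) (refl≐ x)) (refl≐ x)

  ≐-trans⇒ : ⊢ x ≐ y ⇒ y ≐ z ⇒ x ≐ z
  ≐-trans⇒ {x} {y} {z} = ⇒-discharge (≐-transport x x y z) (refl≐ x)

  ≐-euclid⇒ : ⊢ x ≐ z ⇒ y ≐ z ⇒ x ≐ y
  ≐-euclid⇒ = ⇒-trans ≐-trans⇒ (⇒-mono ≐-sym⇒ ⇒-refl)

  ≐-sym : ⊢ x ≐ y → ⊢ y ≐ x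
  ≐-sym = mp ≐-sym⇒

  ≐-trans : ⊢ x ≐ y → ⊢ y ≐ z → ⊢ x ≐ z
  ≐-trans = mp₂ ≐-trans⇒

  ≐-by-definedness : ⊢ (x ↓) ⇒ x ≐ y → ⊢ (y ↓) ⇒ y ≐ x → ⊢ x ≐ y
  ≐-by-definedness {x} {y} x↓⇒x≐y y↓⇒y≐x =
    mp₂ (mp₂ (tautology ((¬ₚ p₀ ⇒ₚ p₂) ⇒ₚ (¬ₚ p₁ ⇒ₚ p₃) ⇒ₚ (p₃ ⇒ₚ p₂) ⇒ₚ (p₀ ⇒ₚ p₁ ⇒ₚ p₂) ⇒ₚ p₂)
                         ((x ↑) ∷ (y ↑) ∷ x ≐ y ∷ y ≐ x ∷ []))
             x↓⇒x≐y y↓⇒y≐x)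
        ≐-sym⇒ ≐-euclid⇒

  cond-cong : ⊢ x ≐ x′ → ⊢ φ ⇔ φ′ → ⊢ y ≐ y′ → ⊢ cond x φ y ≐ cond x′ φ′ y′
  cond-cong {x} {x′} {φ} {φ′} {y} {y′} x≐x′ φ⇔φ′ y≐y′ = by-cases
    (bridge (mp ∧-elimˡ (condAx x φ y)) (⇒-trans (⇔-to φ⇔φ′) (mp ∧-elimˡ (condAx x′ φ′ y′))) x≐x′)
    (bridge (mp ∧-elimʳ (condAx x φ y))
            (⇒-trans (contraposition (⇔-from φ⇔φ′)) (mp ∧-elimʳ (condAx x′ φ′ y′))) y≐y′)
    where
    bridge : ⊢ h ⇒ z ≐ t → ⊢ h ⇒ z′ ≐ t′ → ⊢ t ≐ t′ → ⊢ h ⇒ z ≐ z′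
    bridge z≐t z′≐t′ t≐t′ = lift₂ ≐-euclid⇒ (lift₂ ≐-trans⇒ z≐t (⇒-weaken t≐t′)) z′≐t′

  val-defined-cong : ⊢ x ≐ x′ → ⊢ φ ⇔ φ′ → ⊢ (val x A φ ↓) ⇒ val x A φ ≐ val x′ A φ′
  val-defined-cong {x} {x′} {φ} {φ′} {A} x≐x′ φ⇔φ′ = ⇒-trans possibly-equal (⟨K⟩-elim known)
    where
    u u′ : Term
    u  = val x A φ
    u′ = val x′ A φ′

    knows-u : ⊢ (u ↓) ⇒ K A (φ ⇒ x ≐ u)
    knows-u = ⇒-trans (valDef x A φ) ∧-elimˡ

    knows-u′ : ⊢ (u ↓) ⇒ K A (φ′ ⇒ x′ ≐ u′)
    knows-u′ = ⇒-trans knows-u (⇒-trans (mp (knowAnti A φ′ φ x) (necK A (⇔-from φ⇔φ′)))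
                                        (mp (knowEq A φ′ x x′) (necK A (⇒-weaken x≐x′))))

    agree : ⊢ (φ ⇒ x ≐ u) ⇒ (φ′ ⇒ x′ ≐ u′) ⇒ (φ ⇒ u ≐ u′)
    agree = mp₂ (tautology ((p₀ ⇒ₚ p₁) ⇒ₚ (p₂ ⇒ₚ p₃ ⇒ₚ p₄) ⇒ₚ (p₀ ⇒ₚ p₂) ⇒ₚ (p₁ ⇒ₚ p₃) ⇒ₚ p₀ ⇒ₚ p₄)
                           (φ ∷ φ′ ∷ x ≐ u ∷ x′ ≐ u′ ∷ u ≐ u′ ∷ []))
                (⇔-to φ⇔φ′)
                (⇒-trans ≐-sym⇒ (⇒-trans (⇒-discharge ≐-trans⇒ x≐x′) ≐-trans⇒))

    possibly-equal : ⊢ (u ↓) ⇒ (⟨K A ⟩ (u ≐ u′))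
    possibly-equal = lift₂ ⟨K⟩-distrib (lift₂ (K-normal.mono₂ A agree) knows-u knows-u′)
                                       (⇒-trans (valDef x A φ) ∧-elimʳ)

    known : ⊢ u ≐ u′ ⇒ K A (u ≐ u′)
    known = mp (knowP A Eq (u ∷ u′ ∷ [])) (∧-intro (knowVal A x φ) (∧-intro (knowVal A x′ φ′) ⊢⊤))

  val-cong : ⊢ x ≐ x′ → ⊢ φ ⇔ φ′ → ⊢ val x A φ ≐ val x′ A φ′
  val-cong x≐x′ φ⇔φ′ =
    ≐-by-definedness (val-defined-cong x≐x′ φ⇔φ′) (val-defined-cong (≐-sym x≐x′) (⇔-sym φ⇔φ′))

  ⋀-map-mono : {I : Set} {f g : I → Form} → (∀ i → ⊢ f i ⇒ g i) →
               ∀ is → ⊢ ⋀ (List.map f is) ⇒ ⋀ (List.map g is)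
  ⋀-map-mono f⇒g []       = ⇒-refl
  ⋀-map-mono f⇒g (i ∷ is) = ∧-mono (f⇒g i) (⋀-map-mono f⇒g is)

  C-antitone : ⊢ θ′ ⇒ θ → ⊢ C 𝔄 θ φ ⇒ C 𝔄 θ′ φ
  C-antitone {θ′} {θ} {𝔄} {φ} θ′⇒θ =
    ⇒-trans (mp (indC 𝔄 θ′ (C 𝔄 θ φ)) (necC 𝔄 θ′ fixpoint′))
            (C-normal.mono 𝔄 θ′ (⇒-trans (fixC 𝔄 θ φ) ∧-elimˡ))
    where
    fixpoint′ : ⊢ C 𝔄 θ φ ⇒ ⋀⁺ (map⁺ (λ A → Kθ A θ′ (C 𝔄 θ φ)) 𝔄)
    fixpoint′ = ⇒-trans (⇒-trans (fixC 𝔄 θ φ) ∧-elimʳ)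
                        (⋀-map-mono (λ A → K-normal.mono A (⇒-mono θ′⇒θ ⇒-refl)) (toList 𝔄))

  C-cong : ⊢ θ ⇔ θ′ → ⊢ φ ⇔ φ′ → ⊢ C 𝔄 θ φ ⇔ C 𝔄 θ′ φ′
  C-cong {θ} {θ′} {φ} {φ′} {𝔄} θ⇔θ′ φ⇔φ′ = ∧-intro
    (⇒-trans (C-antitone (⇔-from θ⇔θ′)) (C-normal.mono 𝔄 θ′ (⇔-to φ⇔φ′)))
    (⇒-trans (C-antitone (⇔-to θ⇔θ′)) (C-normal.mono 𝔄 θ (⇔-from φ⇔φ′)))

  upd-cong : ∀ e → ⊢ x ≐ x′ → ⊢ upd e x ≐ upd e x′
  upd-cong {x} {x′} e x≐x′ = ≐-by-definedness
    (⇒-trans (updDef e x) under-pre) (⇒-trans (updDef e x′) (⇒-trans under-pre ≐-sym⇒))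
    where
    under-pre : ⊢ pre e ⇒ upd e x ≐ upd e x′
    under-pre = mp (⇔-to (red[]P e Eq (x ∷ x′ ∷ []))) (nec[] e x≐x′)

  upd-as-cond : ∀ e {π} → ⊢ pre e ⇔ π → ⊢ pre e ⇒ upd e x ≐ t → ⊢ upd e x ≐ cond t π ↑'
  upd-as-cond {x} {t} e {π} pre⇔π pre⇒upd≐t = by-cases
    (lift₂ ≐-euclid⇒ pre⇒upd≐t (⇒-trans (⇔-to pre⇔π) (mp ∧-elimˡ (condAx t π ↑'))))
    (lift₂ ≐-euclid⇒ (contraposition-¬ (updDef e x))
                     (⇒-trans (contraposition (⇔-from pre⇔π)) (mp ∧-elimʳ (condAx t π ↑'))))

  ⇔-reducible : ⊢ φ ⇔ ψ → ReducibleF ψ → ReducibleF φ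
  ⇔-reducible φ⇔ψ (ψ′ , sψ′ , ψ⇔ψ′) = ψ′ , sψ′ , ⇔-trans φ⇔ψ ψ⇔ψ′

  ≐-reducible : ⊢ x ≐ y → ReducibleT y → ReducibleT x
  ≐-reducible x≐y (y′ , sy′ , y≐y′) = y′ , sy′ , ≐-trans x≐y y≐y′

  static-reducible : StaticT x → ReducibleT x
  static-reducible {x} sx = x , sx , refl≐ x

  ⊤-reducible : ReducibleF ⊤'
  ⊤-reducible = ⊤' , pred (const c↑ ∷ const c↑ ∷ []) , ⇔-refl

  ¬-reducible : ReducibleF φ → ReducibleF (¬' φ)
  ¬-reducible (φ′ , sφ′ , φ⇔φ′) = ¬' φ′ , ¬' sφ′ , ¬-cong φ⇔φ′

  ∧-reducible : ReducibleF φ → ReducibleF ψ → ReducibleF (φ ∧' ψ)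
  ∧-reducible (φ′ , sφ′ , φ⇔φ′) (ψ′ , sψ′ , ψ⇔ψ′) = φ′ ∧' ψ′ , sφ′ ∧' sψ′ , ∧-cong φ⇔φ′ ψ⇔ψ′

  ⇒-reducible : ReducibleF φ → ReducibleF ψ → ReducibleF (φ ⇒ ψ)
  ⇒-reducible rφ rψ = ¬-reducible (∧-reducible rφ (¬-reducible rψ))

  ⋀-reducible : AllL ReducibleF Φ → ReducibleF (⋀ Φ)
  ⋀-reducible []         = ⊤-reducible
  ⋀-reducible (rφ ∷ rΦ) = ∧-reducible rφ (⋀-reducible rΦ)

  K-reducible : ReducibleF φ → ReducibleF (K A φ)
  K-reducible {A = A} (φ′ , sφ′ , φ⇔φ′) = K A φ′ , K sφ′ , K-normal.cong A φ⇔φ′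

  C-reducible : ReducibleF θ → ReducibleF φ → ReducibleF (C 𝔄 θ φ)
  C-reducible {𝔄 = 𝔄} (θ′ , sθ′ , θ⇔θ′) (φ′ , sφ′ , φ⇔φ′) = C 𝔄 θ′ φ′ , C sθ′ sφ′ , C-cong θ⇔θ′ φ⇔φ′

  reduct-vec : All ReducibleT xs → Σ (Vec Term n) λ ys → All StaticT ys × (⊢ vecEq xs ys)
  reduct-vec []                    = [] , [] , ⊢⊤
  reduct-vec ((y , sy , x≐y) ∷ rxs) =
    let (ys , sys , xs≐ys) = reduct-vec rxs in y ∷ ys , sy ∷ sys , ∧-intro x≐y xs≐ys

  pred-reducible : All ReducibleT xs → ReducibleF (pred P xs)
  pred-reducible {xs = xs} {P = P} rxs =
    let (ys , sys , xs≐ys) = reduct-vec rxs in pred P ys , pred sys , mp (congP P xs ys) xs≐ys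

  fun-reducible : All ReducibleT xs → ReducibleT (fun F xs)
  fun-reducible {xs = xs} {F = F} rxs =
    let (ys , sys , xs≐ys) = reduct-vec rxs in fun F ys , fun sys , mp (congF F xs ys) xs≐ys

  cond-reducible : ReducibleT x → ReducibleF φ → ReducibleT y → ReducibleT (cond x φ y)
  cond-reducible (x′ , sx′ , x≐x′) (φ′ , sφ′ , φ⇔φ′) (y′ , sy′ , y≐y′) =
    cond x′ φ′ y′ , cond sx′ sφ′ sy′ , cond-cong x≐x′ φ⇔φ′ y≐y′

  val-reducible : ReducibleT x → ReducibleF φ → ReducibleT (val x A φ)
  val-reducible {A = A} (x′ , sx′ , x≐x′) (φ′ , sφ′ , φ⇔φ′) =
    val x′ A φ′ , val sx′ sφ′ , val-cong x≐x′ φ⇔φ′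

  upd-reducible-via : ∀ e → ReducibleF (pre e) → ⊢ pre e ⇒ upd e x ≐ t → ReducibleT t →
                      ReducibleT (upd e x)
  upd-reducible-via e (π , sπ , pre⇔π) pre⇒upd≐t (t′ , st′ , t≐t′) =
    cond t′ π ↑' , cond st′ sπ (const c↑) ,
    upd-as-cond e pre⇔π (lift₂ ≐-trans⇒ pre⇒upd≐t (⇒-weaken t≐t′))

  pre-reducible : ∀ e → ReducibleE e → ReducibleF (pre e)
  pre-reducible (ev _ _ _ _ _) (rΦ , _) = ⋀-reducible rΦ

  post-reducible : ∀ e → ReducibleE e → ∀ v → ReducibleT (post e v)
  post-reducible (ev _ _ _ _ _) (_ , rσ) = rσ

  module UpdateOfStatic (e : Event) (pre-red : ReducibleF (pre e))
                        (post-red : ∀ v → ReducibleT (post e v)) where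

    []¬-reducible : ReducibleF ([ e ] φ) → ReducibleF ([ e ] ¬' φ)
    []¬-reducible r = ⇔-reducible (red[]¬ e _) (⇒-reducible pre-red (¬-reducible r))

    []-static : StaticF φ → ReducibleF ([ e ] φ)
    ⟨⟩-static : StaticF φ → ReducibleF (⟨ e ⟩ φ)
    upd-static : StaticT x → ReducibleT (upd e x)
    upd-static-all : All StaticT xs → All ReducibleT (Vec.map (upd e) xs)

    []-static (pred sxs) =
      ⇔-reducible (red[]P e _ _) (⇒-reducible pre-red (pred-reducible (upd-static-all sxs)))
    []-static (¬' sφ)    = []¬-reducible ([]-static sφ)
    []-static (sφ ∧' sψ) =
      ⇔-reducible ([]-normal.∧-distrib e) (∧-reducible ([]-static sφ) ([]-static sψ))
    []-static (K sφ)     =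
      ⇔-reducible (red[]K e _ _) (⇒-reducible pre-red (K-reducible ([]-static sφ)))
    []-static (C sθ sφ)  =
      ⇔-reducible (red[]C e _ _ _) (⇒-reducible pre-red (C-reducible (⟨⟩-static sθ) ([]-static sφ)))

    ⟨⟩-static sφ = ¬-reducible ([]¬-reducible ([]-static sφ))

    upd-static (const c)       = upd-reducible-via e pre-red (updC e c) (static-reducible (const c))
    upd-static (var v)         = upd-reducible-via e pre-red (updV e v) (post-red v)
    upd-static (cond sx sφ sy) = upd-reducible-via e pre-red (updCond e _ _ _)
      (cond-reducible (upd-static sx) (⟨⟩-static sφ) (upd-static sy))
    upd-static (fun sxs)       = upd-reducible-via e pre-red (updF e _ _)
      (fun-reducible (upd-static-all sxs))
    upd-static (val sx sφ)     = upd-reducible-via e pre-red (updVal e _ _ _)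
      (val-reducible (upd-static sx) (⟨⟩-static sφ))

    upd-static-all []          = []
    upd-static-all (sx ∷ sxs) = upd-static sx ∷ upd-static-all sxs

  []-reducible : ∀ e → ReducibleE e → ReducibleF φ → ReducibleF ([ e ] φ)
  []-reducible e re (φ′ , sφ′ , φ⇔φ′) = ⇔-reducible ([]-normal.cong e φ⇔φ′)
    (UpdateOfStatic.[]-static e (pre-reducible e re) (post-reducible e re) sφ′)

  upd-reducible : ∀ e → ReducibleE e → ReducibleT x → ReducibleT (upd e x)
  upd-reducible e re (x′ , sx′ , x≐x′) = ≐-reducible (upd-cong e x≐x′)
    (UpdateOfStatic.upd-static e (pre-reducible e re) (post-reducible e re) sx′)

  reducibleF : ∀ φ → ReducibleF φ
  reducibleT : ∀ x → ReducibleT x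
  reducibleE : ∀ e → ReducibleE e
  reducible-all : (xs : Vec Term n) → All ReducibleT xs
  reducible-allF : ∀ Φ → AllL ReducibleF Φ

  reducibleF (pred P xs) = pred-reducible (reducible-all xs)
  reducibleF (¬' φ)      = ¬-reducible (reducibleF φ)
  reducibleF (φ ∧' ψ)    = ∧-reducible (reducibleF φ) (reducibleF ψ)
  reducibleF (K A φ)     = K-reducible (reducibleF φ)
  reducibleF (C 𝔄 θ φ)   = C-reducible (reducibleF θ) (reducibleF φ)
  reducibleF ([ e ] φ)   = []-reducible e (reducibleE e) (reducibleF φ)

  reducibleT (const c)    = static-reducible (const c)
  reducibleT (var v)      = static-reducible (var v)
  reducibleT (cond x φ y) = cond-reducible (reducibleT x) (reducibleF φ) (reducibleT y)
  reducibleT (fun F xs)   = fun-reducible (reducible-all xs)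
  reducibleT (val x A φ)  = val-reducible (reducibleT x) (reducibleF φ)
  reducibleT (upd e x)    = upd-reducible e (reducibleE e) (reducibleT x)

  reducibleE (ev Φ σv _ _ _) = reducible-allF Φ , λ v → reducibleT (σv v)

  reducible-all []       = []
  reducible-all (x ∷ xs) = reducibleT x ∷ reducible-all xs

  reducible-allF []      = []
  reducible-allF (φ ∷ Φ) = reducibleF φ ∷ reducible-allF Φ

lemma16 : (𝒱 : Vocabulary) →
    let open Lang 𝒱 in
      ((φ : Form) → ReducibleF φ) × ((x : Term) → ReducibleT x) × ((e : Event) → ReducibleE e)
lemma16 𝒱 = reducibleF 𝒱 , reducibleT 𝒱 , reducibleE 𝒱
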